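{- For all integers $0\le a\le b$, the Sharing Nim game positions $(0,a,b)$ and $(0,b-a,b)$ are isomorphic: there is a bijection $f$ between the set of positions (up to the equivalence described in the context) reachable from $(0,a,b)$ and the set of positions reachable from $(0,b-a,b)$, with $f(0,a,b)=(0,b-a,b)$, such that $x\to x'$ is a move if and only if $f(x)\to f(x')$ is a move.
   Context: Three-pile Sharing Nim: a position is a triple of nonnegative integers (pile sizes). A move consists of taking some positive number $k$ of tokens from one pile and adding them to another pile, provided that after the move the receiving pile does not have more tokens than the source pile; i.e. from $(a,b,c)$ with $a\le b\le c$ one may move to $(a+k,b-k,c)$ with $1\le k\le (b-a)/2$, to $(a+k,b,c-k)$ with $1\le k\le (c-a)/2$, or to $(a,b+k,c-k)$ with $1\le k\le (c-b)/2$. Positions are identified up to reordering the piles and up to adding the same integer to all three piles (so $(a,b,c)$ with $a\le b\le c$ is identified with $(0,b-a,c-a)$); the move relation is compatible with this identification. Two games are isomorphic if there is a one-to-one map $f$ between their position sets such that $x\to x'$ is a move in the first if and only if $f(x)\to f(x')$ is a move in the second. -}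

module Defs where

open import Data.Nat using (ℕ; zero; suc; _+_; _∸_; _≤_; _⊓_; _⊔_)
open import Data.Product using (_×_; _,_; Σ; ∃)
open import Relation.Binary.PropositionalEquality using (_≡_)
open import Relation.Binary.Construct.Closure.ReflexiveTransitive using (Star)
open import Function.Bundles using (_⇔_)

Triple : Set
Triple = ℕ × ℕ × ℕ

-- A raw Sharing Nim move: take k ≥ 1 tokens from a source pile s and add them
-- to a receiving pile r, allowed iff afterwards r + k ≤ s - k, i.e. r + k + k ≤ s.
data RawMove : Triple → Triple → Set where
  m12 : ∀ {x y z} k → 1 ≤ k → y + k + k ≤ x → RawMove (x , y , z) (x ∸ k , y + k , z)
  m13 : ∀ {x y z} k → 1 ≤ k → z + k + k ≤ x → RawMove (x , y , z) (x ∸ k , y , z + k)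
  m21 : ∀ {x y z} k → 1 ≤ k → x + k + k ≤ y → RawMove (x , y , z) (x + k , y ∸ k , z)
  m23 : ∀ {x y z} k → 1 ≤ k → z + k + k ≤ y → RawMove (x , y , z) (x , y ∸ k , z + k)
  m31 : ∀ {x y z} k → 1 ≤ k → x + k + k ≤ z → RawMove (x , y , z) (x + k , y , z ∸ k)
  m32 : ∀ {x y z} k → 1 ≤ k → y + k + k ≤ z → RawMove (x , y , z) (x , y + k , z ∸ k)

-- Positions up to reordering and common translation: the pair (p , q) stands
-- for the class of (0 , p , q); normal forms satisfy p ≤ q.
Pos : Set
Pos = ℕ × ℕ

norm : Triple → Pos
norm (x , y , z) =
  let lo  = x ⊓ (y ⊓ z)
      hi  = x ⊔ (y ⊔ z)
      mid = x + y + z ∸ lo ∸ hi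
  in (mid ∸ lo , hi ∸ lo)

rep : Pos → Triple
rep (p , q) = (0 , p , q)

-- Moves between positions (the move relation is compatible with the identification).
Move : Pos → Pos → Set
Move P Q = Σ Triple (λ t → RawMove (rep P) t × norm t ≡ Q)

Reachable : Pos → Pos → Set
Reachable s P = Star Move s P

record GameIso (s s' : Pos) : Set where
  field
    f         : Pos → Pos
    f-root    : f s ≡ s'
    f-into    : ∀ P → Reachable s P → Reachable s' (f P)
    f-inj     : ∀ P Q → Reachable s P → Reachable s Q → f P ≡ f Q → P ≡ Q
    f-onto    : ∀ Q → Reachable s' Q → ∃ λ P → Reachable s P × f P ≡ Q
    f-move    : ∀ P Q → Reachable s P → Reachable s Q → (Move P Q ⇔ Move (f P) (f Q))

-- The map (p , q) ↦ (q ∸ p , q) is the mirror image x ↦ q ∸ x of the position (0 , p , q),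
-- read up to reordering.  Mirroring a configuration whose piles are at most N sends a move
-- from pile s to pile r by k tokens to a move from pile r to pile s by k tokens, since the
-- condition r + 2k ≤ s becomes (N ∸ s) + 2k ≤ N ∸ r.  On normal forms the map is an
-- involution, hence an isomorphism between the games rooted at (a , b) and (b ∸ a , b).
module Submission where

open import Defs
open import Data.Nat using (ℕ; _+_; _∸_; _≤_; _⊓_; _⊔_; z≤n)
open import Data.Nat.Properties
open import Data.Product using (_,_; _×_; ∃; proj₂)
open import Data.Sum using (inj₁; inj₂)
open import Function using (id; _∘_)
open import Function.Bundles using (mk⇔)
open import Relation.Binary.PropositionalEquality
open import Relation.Binary.Construct.Closure.ReflexiveTransitive using (Star; ε; _◅_; gmap; fold)
open import Algebra.Properties.CommutativeSemigroup ⊓-commutativeSemigroup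
  using () renaming (x∙yz≈y∙xz to ⊓-left-comm)
open import Algebra.Properties.CommutativeSemigroup ⊔-commutativeSemigroup
  using () renaming (x∙yz≈y∙xz to ⊔-left-comm)

m∸[n∸o]≡m∸n+o : ∀ {m n o} → o ≤ n → n ≤ m → m ∸ (n ∸ o) ≡ m ∸ n + o
m∸[n∸o]≡m∸n+o {m} {n} {o} o≤n n≤m = begin
  m ∸ (n ∸ o)                    ≡⟨ cong (_∸ (n ∸ o)) (sym split) ⟩
  m ∸ n + o + (n ∸ o) ∸ (n ∸ o)  ≡⟨ m+n∸n≡m (m ∸ n + o) (n ∸ o) ⟩
  m ∸ n + o                      ∎
  where
  open ≡-Reasoning
  split : m ∸ n + o + (n ∸ o) ≡ m
  split = begin
    m ∸ n + o + (n ∸ o)    ≡⟨ +-assoc (m ∸ n) o (n ∸ o) ⟩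
    m ∸ n + (o + (n ∸ o))  ≡⟨ cong (m ∸ n +_) (m+[n∸m]≡n o≤n) ⟩
    m ∸ n + n              ≡⟨ m∸n+n≡m n≤m ⟩
    m                      ∎

[m∸n]∸[m∸o]≡o∸n : ∀ {m n o} → n ≤ o → o ≤ m → (m ∸ n) ∸ (m ∸ o) ≡ o ∸ n
[m∸n]∸[m∸o]≡o∸n {m} {n} {o} n≤o o≤m = begin
  m ∸ n ∸ (m ∸ o)              ≡⟨ cong (λ v → m ∸ v ∸ (m ∸ o)) (sym (m∸[m∸n]≡n n≤o)) ⟩
  m ∸ (o ∸ (o ∸ n)) ∸ (m ∸ o)  ≡⟨ cong (_∸ (m ∸ o)) (m∸[n∸o]≡m∸n+o (m∸n≤m o n) o≤m) ⟩
  m ∸ o + (o ∸ n) ∸ (m ∸ o)    ≡⟨ m+n∸m≡n (m ∸ o) (o ∸ n) ⟩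
  o ∸ n                        ∎
  where open ≡-Reasoning

[m∸o]∸[n∸o]≡m∸n : ∀ m {n o} → o ≤ n → (m ∸ o) ∸ (n ∸ o) ≡ m ∸ n
[m∸o]∸[n∸o]≡m∸n m {n} {o} o≤n = trans (∸-+-assoc m o (n ∸ o)) (cong (m ∸_) (m+[n∸m]≡n o≤n))

Bounded : ℕ → Triple → Set
Bounded N (x , y , z) = x ≤ N × y ≤ N × z ≤ N

source-bounded : ∀ {N x} k → x ≤ N → x ∸ k ≤ N
source-bounded {x = x} k = ≤-trans (m∸n≤m x k)

receiver-bounded : ∀ {N x} y k → y + k + k ≤ x → x ≤ N → y + k ≤ N
receiver-bounded y k h = ≤-trans (m+n≤o⇒m≤o (y + k) h)

RawMove-bounded : ∀ {N t u} → Bounded N t → RawMove t u → Bounded N u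
RawMove-bounded (x≤N , y≤N , z≤N) (m12 {y = y} k _ h) =
  source-bounded k x≤N , receiver-bounded y k h x≤N , z≤N
RawMove-bounded (x≤N , y≤N , z≤N) (m13 {z = z} k _ h) =
  source-bounded k x≤N , y≤N , receiver-bounded z k h x≤N
RawMove-bounded (x≤N , y≤N , z≤N) (m21 {x = x} k _ h) =
  receiver-bounded x k h y≤N , source-bounded k y≤N , z≤N
RawMove-bounded (x≤N , y≤N , z≤N) (m23 {z = z} k _ h) =
  x≤N , source-bounded k y≤N , receiver-bounded z k h y≤N
RawMove-bounded (x≤N , y≤N , z≤N) (m31 {x = x} k _ h) =
  receiver-bounded x k h z≤N , y≤N , source-bounded k z≤N
RawMove-bounded (x≤N , y≤N , z≤N) (m32 {y = y} k _ h) =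
  x≤N , receiver-bounded y k h z≤N , source-bounded k z≤N

mirror : ℕ → Triple → Triple
mirror N (x , y , z) = (N ∸ z , N ∸ y , N ∸ x)

mirror-source : ∀ {N x y} k → y + k + k ≤ x → x ≤ N → N ∸ (x ∸ k) ≡ N ∸ x + k
mirror-source {y = y} k h = m∸[n∸o]≡m∸n+o (m+n≤o⇒n≤o y (m+n≤o⇒m≤o (y + k) h))

mirror-receiver : ∀ N y k → N ∸ (y + k) ≡ N ∸ y ∸ k
mirror-receiver N y k = sym (∸-+-assoc N y k)

mirror-gap : ∀ {N x y} k → y + k + k ≤ x → x ≤ N → N ∸ x + k + k ≤ N ∸ y
mirror-gap {N} {x} {y} k h x≤N = begin
  N ∸ x + k + k      ≡⟨ +-assoc (N ∸ x) k k ⟩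
  N ∸ x + (k + k)    ≡⟨ sym (m∸[n∸o]≡m∸n+o (m+n≤o⇒n≤o y h′) x≤N) ⟩
  N ∸ (x ∸ (k + k))  ≤⟨ ∸-monoʳ-≤ N (m+n≤o⇒m≤o∸n y h′) ⟩
  N ∸ y              ∎
  where
  open ≤-Reasoning
  h′ : y + (k + k) ≤ x
  h′ = subst (_≤ x) (+-assoc y k k) h

RawMove-mirror : ∀ {N t u} → Bounded N t → RawMove t u → RawMove (mirror N t) (mirror N u)
RawMove-mirror {N} (x≤N , _ , _) (m12 {y = y} k k≥1 h)
  rewrite mirror-source k h x≤N | mirror-receiver N y k = m23 k k≥1 (mirror-gap k h x≤N)
RawMove-mirror {N} (x≤N , _ , _) (m13 {z = z} k k≥1 h)
  rewrite mirror-source k h x≤N | mirror-receiver N z k = m13 k k≥1 (mirror-gap k h x≤N)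
RawMove-mirror {N} (_ , y≤N , _) (m21 {x = x} k k≥1 h)
  rewrite mirror-source k h y≤N | mirror-receiver N x k = m32 k k≥1 (mirror-gap k h y≤N)
RawMove-mirror {N} (_ , y≤N , _) (m23 {z = z} k k≥1 h)
  rewrite mirror-source k h y≤N | mirror-receiver N z k = m12 k k≥1 (mirror-gap k h y≤N)
RawMove-mirror {N} (_ , _ , z≤N) (m31 {x = x} k k≥1 h)
  rewrite mirror-source k h z≤N | mirror-receiver N x k = m31 k k≥1 (mirror-gap k h z≤N)
RawMove-mirror {N} (_ , _ , z≤N) (m32 {y = y} k k≥1 h)
  rewrite mirror-source k h z≤N | mirror-receiver N y k = m21 k k≥1 (mirror-gap k h z≤N)

data Swap : Triple → Triple → Set where
  swap₁₂ : ∀ {x y z} → Swap (x , y , z) (y , x , z)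
  swap₂₃ : ∀ {x y z} → Swap (x , y , z) (x , z , y)

Perm : Triple → Triple → Set
Perm = Star Swap

norm-swap : ∀ {t u} → Swap t u → norm t ≡ norm u
norm-swap (swap₁₂ {x} {y} {z})
  rewrite ⊓-left-comm x y z | ⊔-left-comm x y z | +-comm x y = refl
norm-swap (swap₂₃ {x} {y} {z})
  rewrite ⊓-comm y z | ⊔-comm y z | +-assoc x y z | +-comm y z | +-assoc x z y = refl

Bounded-swap : ∀ {N t u} → Swap t u → Bounded N t → Bounded N u
Bounded-swap swap₁₂ (x≤N , y≤N , z≤N) = y≤N , x≤N , z≤N
Bounded-swap swap₂₃ (x≤N , y≤N , z≤N) = x≤N , z≤N , y≤N

mirror-swap : ∀ {N t u} → Swap t u → Swap (mirror N t) (mirror N u)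
mirror-swap swap₁₂ = swap₂₃
mirror-swap swap₂₃ = swap₁₂

norm-perm : ∀ {t u} → Perm t u → norm t ≡ norm u
norm-perm = fold (λ t u → norm t ≡ norm u) (λ s e → trans (norm-swap s) e) refl

Bounded-perm : ∀ {N t u} → Perm t u → Bounded N t → Bounded N u
Bounded-perm {N} = fold (λ t u → Bounded N t → Bounded N u) (λ s b → b ∘ Bounded-swap s) id

mirror-perm : ∀ {N t u} → Perm t u → Perm (mirror N t) (mirror N u)
mirror-perm {N} = gmap (mirror N) mirror-swap

Sorted : Triple → Set
Sorted (a , b , c) = a ≤ b × b ≤ c

sort : ∀ t → ∃ λ s → Sorted s × Perm t s
sort (x , y , z) with ≤-total x y | ≤-total y z | ≤-total x z
... | inj₁ x≤y | inj₁ y≤z | _        = _ , (x≤y , y≤z) , ε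
... | inj₁ x≤y | inj₂ z≤y | inj₁ x≤z = _ , (x≤z , z≤y) , swap₂₃ ◅ ε
... | inj₁ x≤y | inj₂ z≤y | inj₂ z≤x = _ , (z≤x , x≤y) , swap₂₃ ◅ swap₁₂ ◅ ε
... | inj₂ y≤x | _        | inj₁ x≤z = _ , (y≤x , x≤z) , swap₁₂ ◅ ε
... | inj₂ y≤x | inj₁ y≤z | inj₂ z≤x = _ , (y≤z , z≤x) , swap₁₂ ◅ swap₂₃ ◅ ε
... | inj₂ y≤x | inj₂ z≤y | inj₂ _   = _ , (z≤y , y≤x) , swap₁₂ ◅ swap₂₃ ◅ swap₁₂ ◅ ε

norm-sorted : ∀ {a b c} → a ≤ b → b ≤ c → norm (a , b , c) ≡ (b ∸ a , c ∸ a)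
norm-sorted {a} {b} {c} a≤b b≤c =
  trans (cong₂ (λ l h → (a + b + c ∸ l ∸ h ∸ l , h ∸ l)) lo hi) (cong (λ m → (m ∸ a , c ∸ a)) mid)
  where
  lo : a ⊓ (b ⊓ c) ≡ a
  lo = trans (cong (a ⊓_) (m≤n⇒m⊓n≡m b≤c)) (m≤n⇒m⊓n≡m a≤b)
  hi : a ⊔ (b ⊔ c) ≡ c
  hi = trans (cong (a ⊔_) (m≤n⇒m⊔n≡n b≤c)) (m≤n⇒m⊔n≡n (≤-trans a≤b b≤c))
  mid : a + b + c ∸ a ∸ c ≡ b
  mid = trans (cong (_∸ c) (trans (cong (_∸ a) (+-assoc a b c)) (m+n∸m≡n a (b + c))))
              (m+n∸n≡m b c)

reflect : Pos → Pos
reflect (p , q) = (q ∸ p , q)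

norm-mirror-sorted : ∀ {N a b c} → a ≤ b → b ≤ c → c ≤ N →
                     norm (mirror N (a , b , c)) ≡ reflect (norm (a , b , c))
norm-mirror-sorted {N} {a} {b} {c} a≤b b≤c c≤N = begin
  norm (N ∸ c , N ∸ b , N ∸ a)
    ≡⟨ norm-sorted (∸-monoʳ-≤ N b≤c) (∸-monoʳ-≤ N a≤b) ⟩
  (N ∸ b ∸ (N ∸ c) , N ∸ a ∸ (N ∸ c))
    ≡⟨ cong₂ _,_ ([m∸n]∸[m∸o]≡o∸n b≤c c≤N) ([m∸n]∸[m∸o]≡o∸n (≤-trans a≤b b≤c) c≤N) ⟩
  (c ∸ b , c ∸ a)
    ≡⟨ cong (_, c ∸ a) ([m∸o]∸[n∸o]≡m∸n c a≤b) ⟨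
  reflect (b ∸ a , c ∸ a)
    ≡⟨ cong reflect (norm-sorted a≤b b≤c) ⟨
  reflect (norm (a , b , c))
    ∎
  where open ≡-Reasoning

norm-mirror : ∀ {N t} → Bounded N t → norm (mirror N t) ≡ reflect (norm t)
norm-mirror {N} {t} t≤N with sort t
... | (a , b , c) , (a≤b , b≤c) , t∼s = begin
  norm (mirror N t)          ≡⟨ norm-perm (mirror-perm t∼s) ⟩
  norm (mirror N (a , b , c)) ≡⟨ norm-mirror-sorted a≤b b≤c (proj₂ (proj₂ (Bounded-perm t∼s t≤N))) ⟩
  reflect (norm (a , b , c)) ≡⟨ cong reflect (norm-perm t∼s) ⟨
  reflect (norm t)           ∎
  where open ≡-Reasoning

Normal : Pos → Set
Normal (p , q) = p ≤ q

norm-normal : ∀ t → Normal (norm t)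
norm-normal t with sort t
... | (a , b , c) , (a≤b , b≤c) , t∼s =
  subst Normal (sym (trans (norm-perm t∼s) (norm-sorted a≤b b≤c))) (∸-monoˡ-≤ a b≤c)

reflect-normal : ∀ P → Normal (reflect P)
reflect-normal (p , q) = m∸n≤m q p

reflect-involutive : ∀ {P} → Normal P → reflect (reflect P) ≡ P
reflect-involutive {p , q} p≤q = cong (_, q) (m∸[m∸n]≡n p≤q)

Move-normal : ∀ {P Q} → Move P Q → Normal Q
Move-normal (t , _ , refl) = norm-normal t

Reachable-normal : ∀ {s P} → Normal s → Reachable s P → Normal P
Reachable-normal s-nf ε       = s-nf
Reachable-normal _    (m ◅ r) = Reachable-normal (Move-normal m) r

Move-reflect : ∀ {P Q} → Normal P → Move P Q → Move (reflect P) (reflect Q)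
Move-reflect {p , q} p≤q (t , m , refl) =
  mirror q t , subst (λ r → RawMove r (mirror q t)) root (RawMove-mirror bounded m) ,
  norm-mirror (RawMove-bounded bounded m)
  where
  bounded : Bounded q (0 , p , q)
  bounded = z≤n , p≤q , ≤-refl
  root : mirror q (0 , p , q) ≡ rep (reflect (p , q))
  root = cong (_, q ∸ p , q) (n∸n≡0 q)

Reachable-reflect : ∀ {s P} → Normal s → Reachable s P → Reachable (reflect s) (reflect P)
Reachable-reflect _    ε       = ε
Reachable-reflect s-nf (m ◅ r) = Move-reflect s-nf m ◅ Reachable-reflect (Move-normal m) r

mainTheorem3 : (a b : ℕ) → a ≤ b → GameIso (a , b) (b ∸ a , b)
mainTheorem3 a b a≤b = record
  { f      = reflect
  ; f-root = refl
  ; f-into = λ _ → Reachable-reflect a≤b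
  ; f-inj  = λ P Q rP rQ e → begin
      P                   ≡⟨ reflect-involutive (normal rP) ⟨
      reflect (reflect P) ≡⟨ cong reflect e ⟩
      reflect (reflect Q) ≡⟨ reflect-involutive (normal rQ) ⟩
      Q                   ∎
  ; f-onto = λ Q r → reflect Q ,
      subst (λ s → Reachable s (reflect Q)) (reflect-involutive a≤b)
            (Reachable-reflect (reflect-normal (a , b)) r) ,
      reflect-involutive (Reachable-normal (reflect-normal (a , b)) r)
  ; f-move = λ P Q rP rQ → mk⇔ (Move-reflect (normal rP))
      (λ m → subst₂ Move (reflect-involutive (normal rP)) (reflect-involutive (normal rQ))
                        (Move-reflect (reflect-normal P) m))
  }
  where
  open ≡-Reasoning
  normal : ∀ {P} → Reachable (a , b) P → Normal P
  normal = Reachable-normal a≤b
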